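{- Let $P$ be a finite bounded poset with a left modular maximal chain $M$. Let $y\le z$ in $P$, let $t\le u$ be elements of $[y,z]$, and let $x\in M$. Let $w=(x\vee y)\wedge_y z=(x\wedge z)\vee^z y$. Then $(w\vee^z t)\wedge_t u$ and $(w\wedge_y u)\vee^u t$ are well-defined elements of $[t,u]$, and they are equal.
   Context: A poset is bounded if it has unique minimum $\hat0$ and maximum $\hat1$. $x\vee y$, $x\wedge y$ denote least common upper bound / greatest common lower bound when they exist. For $w,z\ge y$, $w\wedge_y z$ is the greatest element of $\{u: y\le u\le w,\ u\le z\}$ if it exists; for $w,y\le z$, $w\vee^z y$ is the least element of $\{u: w,y\le u\le z\}$ if it exists. An element $x$ is viable if for all $y\le z$ both $(x\vee y)\wedge_y z$ and $(x\wedge z)\vee^z y$ exist; a viable $x$ is left modular if $(x\vee y)\wedge_y z=(x\wedge z)\vee^z y$ for all $y\le z$. A maximal chain is left modular if all its elements are viable and left modular. -}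

module Defs where

open import Level using (Level; _⊔_; suc)
open import Data.Product using (Σ; ∃; _×_; _,_)
open import Data.Sum using (_⊎_)
open import Data.List using (List)
open import Data.List.Relation.Unary.Any using (Any)
open import Relation.Binary.Bundles using (Poset)

module PosetDefs {c ℓ₁ ℓ₂ : Level} (P : Poset c ℓ₁ ℓ₂) where
  open Poset P renaming (Carrier to A)

  IsLeast : ∀ {p} → (A → Set p) → A → Set (c ⊔ ℓ₂ ⊔ p)
  IsLeast S a = S a × (∀ b → S b → a ≤ b)

  IsGreatest : ∀ {p} → (A → Set p) → A → Set (c ⊔ ℓ₂ ⊔ p)
  IsGreatest S a = S a × (∀ b → S b → b ≤ a)

  Finite : Set (c ⊔ ℓ₁)
  Finite = Σ (List A) λ xs → ∀ x → Any (x ≈_) xs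

  Bounded : Set (c ⊔ ℓ₂)
  Bounded = Σ A λ bot → Σ A λ top → (∀ x → bot ≤ x) × (∀ x → x ≤ top)

  Join : A → A → A → Set (c ⊔ ℓ₂)
  Join x y j = IsLeast (λ u → x ≤ u × y ≤ u) j

  Meet : A → A → A → Set (c ⊔ ℓ₂)
  Meet x y m = IsGreatest (λ u → u ≤ x × u ≤ y) m

  -- m = w ∧_y z : greatest element of {u : y ≤ u ≤ w, u ≤ z}
  RelMeet : A → A → A → A → Set (c ⊔ ℓ₂)
  RelMeet y w z m = IsGreatest (λ u → (y ≤ u × u ≤ w) × u ≤ z) m

  -- j = w ∨^z y : least element of {u : w ≤ u, y ≤ u, u ≤ z}
  RelJoin : A → A → A → A → Set (c ⊔ ℓ₂)
  RelJoin w y z j = IsLeast (λ u → (w ≤ u × y ≤ u) × u ≤ z) j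

  LeftVal : A → A → A → A → Set (c ⊔ ℓ₂)
  LeftVal x y z v = Σ A λ j → Join x y j × RelMeet y j z v

  RightVal : A → A → A → A → Set (c ⊔ ℓ₂)
  RightVal x y z v = Σ A λ m → Meet x z m × RelJoin m y z v

  Viable : A → Set (c ⊔ ℓ₂)
  Viable x = ∀ y z → y ≤ z → (Σ A (LeftVal x y z)) × (Σ A (RightVal x y z))

  LeftModular : A → Set (c ⊔ ℓ₁ ⊔ ℓ₂)
  LeftModular x = ∀ y z → y ≤ z → ∀ v v' → LeftVal x y z v → RightVal x y z v' → v ≈ v'

  Comparable : A → A → Set ℓ₂
  Comparable a b = a ≤ b ⊎ b ≤ a

  IsChain : ∀ {p} → (A → Set p) → Set (c ⊔ ℓ₂ ⊔ p)
  IsChain M = ∀ a b → M a → M b → Comparable a b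

  IsMaximalChain : ∀ {p} → (A → Set p) → Set (c ⊔ ℓ₂ ⊔ p)
  IsMaximalChain M = IsChain M × (∀ a → (∀ b → M b → Comparable a b) → M a)

  IsLeftModularChain : ∀ {p} → (A → Set p) → Set (c ⊔ ℓ₁ ⊔ ℓ₂ ⊔ p)
  IsLeftModularChain M = IsMaximalChain M × (∀ x → M x → Viable x × LeftModular x)

{-# OPTIONS --safe #-}
module Submission where

-- Since y ≤ t, the upper bounds of
-- {w, t} below z are exactly those of {x ∧ z, t}, so w ∨^z t = (x ∧ z) ∨^z t,
-- which by left modularity of x is (x ∨ t) ∧_t z; meeting with u inside [t, u]
-- gives (x ∨ t) ∧_t u.  Dually w ∧_y u = (x ∨ y) ∧_y u = (x ∧ u) ∨^u y, and
-- joining with t gives (x ∧ u) ∨^u t.  These agree by left modularity at t ≤ u.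

open import Defs
open import Level using (Level)
open import Data.Product using (Σ; _×_; _,_)
open import Relation.Binary.Bundles using (Poset)
open import Relation.Unary using (Pred; _≐_)

module RelativeOperations {c ℓ₁ ℓ₂ : Level} (P : Poset c ℓ₁ ℓ₂) where
  open Poset P renaming (Carrier to A)
  open PosetDefs P

  private
    variable
      p : Level
      S T : Pred A p
      a a′ m m′ j j′ v l r x y z t u : A

  IsLeast-resp-≐ : S ≐ T → IsLeast S a → IsLeast T a
  IsLeast-resp-≐ (S⊆T , T⊆S) (a∈S , least) = S⊆T a∈S , λ b b∈T → least b (T⊆S b∈T)

  IsGreatest-resp-≐ : S ≐ T → IsGreatest S a → IsGreatest T a
  IsGreatest-resp-≐ (S⊆T , T⊆S) (a∈S , greatest) = S⊆T a∈S , λ b b∈T → greatest b (T⊆S b∈T)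

  IsLeast-unique : IsLeast S a → IsLeast S a′ → a ≈ a′
  IsLeast-unique (a∈S , least) (a′∈S , least′) = antisym (least _ a′∈S) (least′ _ a∈S)

  IsGreatest-unique : IsGreatest S a → IsGreatest S a′ → a ≈ a′
  IsGreatest-unique (a∈S , greatest) (a′∈S , greatest′) =
    antisym (greatest′ _ a∈S) (greatest _ a′∈S)

  RelMeet-between : RelMeet y j z m → y ≤ m × m ≤ z
  RelMeet-between (((y≤m , _) , m≤z) , _) = y≤m , m≤z

  RelJoin-between : RelJoin m y z j → y ≤ j × j ≤ z
  RelJoin-between (((_ , y≤j) , j≤z) , _) = y≤j , j≤z

  RelMeet-respˡ-≈ : j ≈ j′ → RelMeet y j z m → RelMeet y j′ z m
  RelMeet-respˡ-≈ j≈j′ = IsGreatest-resp-≐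
    ( (λ { ((y≤b , b≤j) , b≤z) → (y≤b , ≤-respʳ-≈ j≈j′ b≤j) , b≤z })
    , (λ { ((y≤b , b≤j′) , b≤z) → (y≤b , ≤-respʳ-≈ (Eq.sym j≈j′) b≤j′) , b≤z }))

  RelJoin-respˡ-≈ : m ≈ m′ → RelJoin m y z j → RelJoin m′ y z j
  RelJoin-respˡ-≈ m≈m′ = IsLeast-resp-≐
    ( (λ { ((m≤b , y≤b) , b≤z) → (≤-respˡ-≈ m≈m′ m≤b , y≤b) , b≤z })
    , (λ { ((m′≤b , y≤b) , b≤z) → (≤-respˡ-≈ (Eq.sym m≈m′) m′≤b , y≤b) , b≤z }))

  RelMeet-nested : u ≤ z → RelMeet t j z v → RelMeet t j u l → RelMeet t v u l
  RelMeet-nested u≤z (((_ , v≤j) , _) , greatest) = IsGreatest-resp-≐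
    ( (λ { ((t≤b , b≤j) , b≤u) → (t≤b , greatest _ ((t≤b , b≤j) , trans b≤u u≤z)) , b≤u })
    , (λ { ((t≤b , b≤v) , b≤u) → (t≤b , trans b≤v v≤j) , b≤u }))

  RelJoin-nested : y ≤ t → RelJoin m y z v → RelJoin m t z r → RelJoin v t z r
  RelJoin-nested y≤t (((m≤v , _) , _) , least) = IsLeast-resp-≐
    ( (λ { ((m≤b , t≤b) , b≤z) → (least _ ((m≤b , trans y≤t t≤b) , b≤z) , t≤b) , b≤z })
    , (λ { ((v≤b , t≤b) , b≤z) → (trans m≤v v≤b , t≤b) , b≤z }))

  RelMeet-of-LeftVal : u ≤ z → LeftVal x t z v → LeftVal x t u l → RelMeet t v u l
  RelMeet-of-LeftVal u≤z (j , j-join , v-meet) (j′ , j′-join , l-meet) =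
    RelMeet-nested u≤z v-meet (RelMeet-respˡ-≈ (IsLeast-unique j′-join j-join) l-meet)

  RelJoin-of-RightVal : y ≤ t → RightVal x y z v → RightVal x t z r → RelJoin v t z r
  RelJoin-of-RightVal y≤t (m , m-meet , v-join) (m′ , m′-meet , r-join) =
    RelJoin-nested y≤t v-join (RelJoin-respˡ-≈ (IsGreatest-unique m′-meet m-meet) r-join)

lemma3 : ∀ {c ℓ₁ ℓ₂ p : Level} (P : Poset c ℓ₁ ℓ₂) → PosetDefs.Finite P → PosetDefs.Bounded P
    → (M : Poset.Carrier P → Set p) → PosetDefs.IsLeftModularChain P M
    → (y z t u x w : Poset.Carrier P)
    → Poset._≤_ P y z → Poset._≤_ P y t → Poset._≤_ P t u → Poset._≤_ P u z
    → M x
    → PosetDefs.LeftVal P x y z w → PosetDefs.RightVal P x y z w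
    → Σ (Poset.Carrier P) λ a → PosetDefs.RelJoin P w t z a
    × Σ (Poset.Carrier P) λ b → PosetDefs.RelMeet P t a u b
    × Σ (Poset.Carrier P) λ d → PosetDefs.RelMeet P y w u d
    × Σ (Poset.Carrier P) λ e → PosetDefs.RelJoin P d t u e
    × (Poset._≤_ P t b × Poset._≤_ P b u)
    × (Poset._≤_ P t e × Poset._≤_ P e u)
    × Poset._≈_ P b e
lemma3 P _ _ M (_ , leftModularChain) y z t u x w _ y≤t t≤u u≤z x∈M w-left w-right
  with (viable , modular) ← leftModularChain x x∈M
     | t≤z ← Poset.trans P t≤u u≤z
     | y≤u ← Poset.trans P y≤t t≤u
  with ((ltz , ltz-left) , (rtz , rtz-right)) ← viable t z t≤z
     | ((ltu , ltu-left) , (rtu , rtu-right)) ← viable t u t≤u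
     | ((lyu , lyu-left) , (ryu , ryu-right)) ← viable y u y≤u
  = rtz , w∨t , ltu , a∧u , lyu , w∧u , rtu , d∨t ,
    RelMeet-between a∧u , RelJoin-between d∨t , modular t u t≤u ltu rtu ltu-left rtu-right
  where
  open Poset P
  open PosetDefs P
  open RelativeOperations P

  w∨t : RelJoin w t z rtz
  w∨t = RelJoin-of-RightVal y≤t w-right rtz-right

  a∧u : RelMeet t rtz u ltu
  a∧u = RelMeet-respˡ-≈ (modular t z t≤z ltz rtz ltz-left rtz-right)
                        (RelMeet-of-LeftVal u≤z ltz-left ltu-left)

  w∧u : RelMeet y w u lyu
  w∧u = RelMeet-of-LeftVal u≤z w-left lyu-left

  d∨t : RelJoin lyu t u rtu
  d∨t = RelJoin-respˡ-≈ (Eq.sym (modular y u y≤u lyu ryu lyu-left ryu-right))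
                        (RelJoin-of-RightVal y≤t ryu-right rtu-right)
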